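{- Let $n$ be a positive integer. For any positive integer $c\leq n-1$, there is an arithmetical structure on $K_n$ with $r_1=c$.
   Context: An arithmetical structure on the complete graph $K_n$ (with $n$ vertices) is a collection of positive integers $r_1,r_2,\dotsc,r_n$ with $\gcd(r_1,\dotsc,r_n)=1$ such that $r_j$ divides $\sum_{i=1}^n r_i$ for every $j$. The values are ordered so that $r_1\geq r_2\geq\dotsb\geq r_n$; thus $r_1$ is the largest value of the structure. -}

module Defs where

open import Data.Nat using (ℕ; zero; suc; _≤_; _≥_; _<_)
open import Data.Nat.Divisibility using (_∣_)
open import Data.Nat.GCD using (gcd)
open import Data.Fin using (Fin; zero; suc; _<_)
open import Data.Vec using (Vec; lookup; foldr; sum)
open import Relation.Binary.PropositionalEquality using (_≡_)
open import Data.Product using (_×_)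

gcdVec : ∀ {n} → Vec ℕ n → ℕ
gcdVec = foldr _ gcd 0

-- An arithmetical structure on the complete graph K_n:
-- positive integers r_1 ≥ r_2 ≥ … ≥ r_n with gcd 1 and each r_j ∣ Σ r_i.
-- Entries are indexed by Fin n (index zero = r_1).
record IsArithStructK {n : ℕ} (r : Vec ℕ n) : Set where
  field
    positive  : ∀ (i : Fin n) → 1 ≤ lookup r i
    ordered   : ∀ (i j : Fin n) → i Data.Fin.< j → lookup r j ≤ lookup r i
    gcd-one   : gcdVec r ≡ 1
    divides   : ∀ (j : Fin n) → lookup r j ∣ sum r

{-# OPTIONS --safe #-}
module Submission where

-- Take n − c copies of c followed by c ones. The sum is (n − c) c + c = (n − c + 1) c,
-- which both values divide, the ones force the gcd to be 1, and the largest value is c.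

open import Defs
open import Data.Nat using (ℕ; zero; suc; _≤_; _∸_; _+_; _*_; s≤s)
open import Data.Nat.Properties using (m∸n+n≡m; ≤-refl)
open import Data.Nat.Divisibility using (_∣_; ∣-trans; ∣1⇒≡1; 1∣_; m∣m*n; n∣m*n; ∣m∣n⇒∣m+n)
open import Data.Nat.GCD using (gcd[m,n]∣m; gcd[m,n]∣n)
open import Data.Fin using (zero; suc; _↑ʳ_)
import Data.Fin as Fin
open import Data.Vec using (Vec; lookup; _∷_; _++_; replicate; sum)
open import Data.Vec.Properties using (sum-++; lookup-++ʳ)
open import Data.Vec.Relation.Unary.All as All using (All; _∷_)
open import Data.Vec.Relation.Unary.All.Properties using (lookup⁺; ++⁺)
open import Data.Vec.Relation.Unary.AllPairs as AllPairs using (AllPairs; _∷_)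
import Data.Vec.Relation.Unary.AllPairs.Properties as AllPairsₚ
open import Data.Product using (Σ; _×_; _,_)
open import Relation.Binary.Core using (Rel)
open import Relation.Binary.PropositionalEquality using (_≡_; refl; sym; subst; cong; cong₂; trans)
open import Relation.Unary using (Pred)

All-replicate : ∀ {a p} {A : Set a} {P : Pred A p} n {x} → P x → All P (replicate n x)
All-replicate zero    px = All.[]
All-replicate (suc n) px = px ∷ All-replicate n px

AllPairs-replicate : ∀ {a r} {A : Set a} {R : Rel A r} n {x} → R x x → AllPairs R (replicate n x)
AllPairs-replicate zero    rxx = AllPairs.[]
AllPairs-replicate (suc n) rxx = All-replicate n rxx ∷ AllPairs-replicate n rxx

AllPairs-lookup : ∀ {a r} {A : Set a} {R : Rel A r} {n} {xs : Vec A n} → AllPairs R xs →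
                  ∀ {i j} → i Fin.< j → R (lookup xs i) (lookup xs j)
AllPairs-lookup (rx ∷ rxs) {zero}  {suc j} _         = lookup⁺ rx j
AllPairs-lookup (rx ∷ rxs) {suc i} {suc j} (s≤s i<j) = AllPairs-lookup rxs i<j

sum-replicate : ∀ n x → sum (replicate n x) ≡ n * x
sum-replicate zero    x = refl
sum-replicate (suc n) x = cong (x +_) (sum-replicate n x)

gcdVec-∣-lookup : ∀ {n} (xs : Vec ℕ n) i → gcdVec xs ∣ lookup xs i
gcdVec-∣-lookup (x ∷ xs) zero    = gcd[m,n]∣m x (gcdVec xs)
gcdVec-∣-lookup (x ∷ xs) (suc i) = ∣-trans (gcd[m,n]∣n x (gcdVec xs)) (gcdVec-∣-lookup xs i)

gcdVec≡1 : ∀ {n} (xs : Vec ℕ n) i → lookup xs i ≡ 1 → gcdVec xs ≡ 1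
gcdVec≡1 xs i xᵢ≡1 = ∣1⇒≡1 (subst (gcdVec xs ∣_) xᵢ≡1 (gcdVec-∣-lookup xs i))

copiesThenOnes : ∀ p c → Vec ℕ (p + c)
copiesThenOnes p c = replicate p c ++ replicate c 1

sum-copiesThenOnes : ∀ p c → sum (copiesThenOnes p c) ≡ p * c + c * 1
sum-copiesThenOnes p c =
  trans (sum-++ (replicate p c)) (cong₂ _+_ (sum-replicate p c) (sum-replicate c 1))

copiesThenOnes-decreasing : ∀ p {c} → 1 ≤ c → AllPairs (λ x y → y ≤ x) (copiesThenOnes p c)
copiesThenOnes-decreasing p {c} 1≤c = AllPairsₚ.++⁺
  (AllPairs-replicate p ≤-refl)
  (AllPairs-replicate c ≤-refl)
  (All-replicate p (All-replicate c 1≤c))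

copiesThenOnes-gcd : ∀ p {c} → 1 ≤ c → gcdVec (copiesThenOnes p c) ≡ 1
copiesThenOnes-gcd p {suc k} _ =
  gcdVec≡1 (copiesThenOnes p (suc k)) (p ↑ʳ zero) (lookup-++ʳ (replicate p (suc k)) _ zero)

copiesThenOnes-isArithStructK : ∀ p {c} → 1 ≤ c → IsArithStructK (copiesThenOnes p c)
copiesThenOnes-isArithStructK p {c} 1≤c = record
  { positive = lookup⁺ positive
  ; ordered  = λ _ _ → AllPairs-lookup (copiesThenOnes-decreasing p 1≤c)
  ; gcd-one  = copiesThenOnes-gcd p 1≤c
  ; divides  = lookup⁺ divide-sum
  }
  where
  positive : All (1 ≤_) (copiesThenOnes p c)
  positive = ++⁺ (All-replicate p 1≤c) (All-replicate c ≤-refl)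

  c∣sum : c ∣ sum (copiesThenOnes p c)
  c∣sum = subst (c ∣_) (sym (sum-copiesThenOnes p c)) (∣m∣n⇒∣m+n (n∣m*n p) (m∣m*n 1))

  divide-sum : All (_∣ sum (copiesThenOnes p c)) (copiesThenOnes p c)
  divide-sum = ++⁺ (All-replicate p c∣sum) (All-replicate c (1∣ _))

proposition2p2 : (m : ℕ) → (c : ℕ) → 1 ≤ c → c ≤ suc m ∸ 1 →
    Σ (Vec ℕ (suc m)) (λ r → IsArithStructK r × lookup r zero ≡ c)
proposition2p2 m c 1≤c c≤m =
  subst (λ n → Σ (Vec ℕ (suc n)) (λ r → IsArithStructK r × lookup r zero ≡ c))
        (m∸n+n≡m c≤m)
        (copiesThenOnes (suc (m ∸ c)) c , copiesThenOnes-isArithStructK (suc (m ∸ c)) 1≤c , refl)
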